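{- $\mathrm{PL}(\mathrm{NE},\veebar)$ is both bicomplete and bicomplete modulo expressive power for ground-incompatible pairs.
   Context: $\mathrm{PL}(\mathrm{NE},\veebar)$: $\phi ::= p \mid \bot \mid \neg\phi \mid \phi\wedge\phi \mid \phi\vee\phi \mid \mathrm{NE} \mid \phi\veebar\phi$, on propositional teams with support $\models$ / anti-support $\models^-$: $p$ supported iff all $w\in s$ make $p$ true, anti-supported iff none do; $s\models\bot$ iff $s=\emptyset$, $\bot$ always anti-supported; $s\models\mathrm{NE}$ iff $s\ne\emptyset$, $s\models^-\mathrm{NE}$ iff $s=\emptyset$; $\neg$ swaps support and anti-support; $\wedge$ supported iff both are, anti-supported iff $s=t\cup u$ with $t\models^-\phi,u\models^-\psi$; $\vee$ supported iff $s=t\cup u$ with $t\models\phi,u\models\psi$, anti-supported iff both are; $\veebar$ supported iff one disjunct is, anti-supported iff both are. Team properties over finite $\mathsf{X}$ are sets of teams $s\subseteq 2^\mathsf{X}$; $\|\phi\|_\mathsf{X}$ is the set of teams supporting $\phi$. $\mathcal{P},\mathcal{Q}$ are ground-incompatible if $\bigcup\mathcal{P}\cap\bigcup\mathcal{Q}=\emptyset$. $L$ is bicomplete for a class $\mathscr{P}$ of pairs if for every finite $\mathsf{X}$, $\{(\|\phi\|_\mathsf{X},\|\neg\phi\|_\mathsf{X})\mid\phi\in L\}$ equals the pairs of $\mathscr{P}$ over $\mathsf{X}$; bicomplete modulo expressive power if bicomplete for $\mathscr{P}$ restricted to pairs of properties expressible in $L$. -}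

module Defs where

open import Data.Nat using (ℕ)
open import Data.Fin using (Fin)
open import Data.Bool using (Bool; true; false; T; _∨_)
open import Data.Vec using (Vec; lookup)
open import Data.Product using (Σ; ∃; ∃-syntax; _×_; _,_)
open import Data.Sum using (_⊎_)
open import Data.Empty using (⊥)
import Data.Unit
open import Relation.Binary.PropositionalEquality using (_≡_)
open import Function.Bundles using (_⇔_)

data Form (n : ℕ) : Set where
  atom : Fin n → Form n
  bot  : Form n
  ¬ᶠ_  : Form n → Form n
  _∧ᶠ_ : Form n → Form n → Form n
  _∨ᶠ_ : Form n → Form n → Form n
  NE   : Form n
  _⊻_  : Form n → Form n → Form n

-- Propositional teams: valuations are elements of 2^X (here Vec Bool n),
-- a team s ⊆ 2^X is given by its characteristic function.

Valuation : ℕ → Set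
Valuation n = Vec Bool n

Team : ℕ → Set
Team n = Valuation n → Bool

_∈ₜ_ : ∀ {n} → Valuation n → Team n → Set
w ∈ₜ s = s w ≡ true

Empty : ∀ {n} → Team n → Set
Empty s = ∀ w → s w ≡ false

NonEmpty : ∀ {n} → Team n → Set
NonEmpty s = ∃[ w ] (w ∈ₜ s)

IsUnion : ∀ {n} → Team n → Team n → Team n → Set
IsUnion s t u = ∀ w → s w ≡ (t w ∨ u w)

mutual
  _⊨_ : ∀ {n} → Team n → Form n → Set
  s ⊨ atom p  = ∀ w → w ∈ₜ s → lookup w p ≡ true
  s ⊨ bot     = Empty s
  s ⊨ (¬ᶠ φ)  = s ⊨⁻ φ
  s ⊨ (φ ∧ᶠ ψ) = (s ⊨ φ) × (s ⊨ ψ)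
  s ⊨ (φ ∨ᶠ ψ) = ∃[ t ] ∃[ u ] (IsUnion s t u × (t ⊨ φ) × (u ⊨ ψ))
  s ⊨ NE      = NonEmpty s
  s ⊨ (φ ⊻ ψ) = (s ⊨ φ) ⊎ (s ⊨ ψ)

  _⊨⁻_ : ∀ {n} → Team n → Form n → Set
  s ⊨⁻ atom p  = ∀ w → w ∈ₜ s → lookup w p ≡ false
  s ⊨⁻ bot     = Data.Unit.⊤
  s ⊨⁻ (¬ᶠ φ)  = s ⊨ φ
  s ⊨⁻ (φ ∧ᶠ ψ) = ∃[ t ] ∃[ u ] (IsUnion s t u × (t ⊨⁻ φ) × (u ⊨⁻ ψ))
  s ⊨⁻ (φ ∨ᶠ ψ) = (s ⊨⁻ φ) × (s ⊨⁻ ψ)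
  s ⊨⁻ NE      = Empty s
  s ⊨⁻ (φ ⊻ ψ) = (s ⊨⁻ φ) × (s ⊨⁻ ψ)

-- Team properties over X = Fin n: sets of teams, given by (extensional)
-- characteristic functions on teams.

TeamProp : ℕ → Set
TeamProp n = Team n → Bool

Extensional : ∀ {n} → TeamProp n → Set
Extensional {n} P = ∀ (s t : Team n) → (∀ w → s w ≡ t w) → P s ≡ P t

_≐_ : ∀ {n} → (Team n → Set) → TeamProp n → Set
_≐_ {n} S P = ∀ (s : Team n) → S s ⇔ (P s ≡ true)

‖_‖ : ∀ {n} → Form n → Team n → Set
‖ φ ‖ s = s ⊨ φ

GroundIncompatible : (n : ℕ) → TeamProp n → TeamProp n → Set
GroundIncompatible n P Q =
  ∀ (s t : Team n) (w : Valuation n) →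
    P s ≡ true → Q t ≡ true → w ∈ₜ s → w ∈ₜ t → ⊥

PairClass : Set₁
PairClass = (n : ℕ) → TeamProp n → TeamProp n → Set

Expressible : (n : ℕ) → TeamProp n → Set
Expressible n P = ∃[ φ ] (‖_‖ {n} φ ≐ P)

ModuloExpressivePower : PairClass → PairClass
ModuloExpressivePower C n P Q = C n P Q × Expressible n P × Expressible n Q

Bicomplete : PairClass → Set
Bicomplete C = ∀ (n : ℕ) →
  (∀ (φ : Form n) → ∃[ P ] ∃[ Q ]
      (Extensional P × Extensional Q × C n P Q ×
       (‖ φ ‖ ≐ P) × (‖ ¬ᶠ φ ‖ ≐ Q)))
  ×
  (∀ (P Q : TeamProp n) → Extensional P → Extensional Q → C n P Q →
      ∃[ φ ] ((‖ φ ‖ ≐ P) × (‖ ¬ᶠ φ ‖ ≐ Q)))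

{-# OPTIONS --safe #-}

-- Soundness: over a finite X there are finitely many teams, so support and anti-support
-- are decidable, hence Bool-valued extensional properties; and no valuation lies both in a
-- team supporting φ and in one anti-supporting φ, which is ground-incompatibility.
--
-- Completeness: δ w ∧ NE is supported exactly by the team {w}, so the split disjunction
-- χ s of these over w ∈ s is supported exactly by s, and anti-supported by every team
-- disjoint from s. Hence α P, the global disjunction of χ s over s ∈ P, is supported
-- exactly by the teams in P and anti-supported by every team disjoint from ⋃P. For a
-- ground-incompatible pair (P, Q) every team in Q is such a team, and the formula
-- α P ⊻ ¬(α Q ∧ ¬(⊥ ∧ NE)) then has support P and anti-support Q.

module Submission where

open import Defs
open import Data.Bool using (Bool; true; false; not; _∧_; _∨_; T?) renaming (_≟_ to _≟ᵇ_)
open import Data.Bool.Properties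
  using (∨-identityʳ; ∨-inverseˡ; ∧-identityʳ; ∧-distribˡ-∨; ∧-conicalˡ; ∧-conicalʳ; ¬-not; ⇔→≡; T-≡)
open import Data.Empty using (⊥; ⊥-elim)
open import Data.Fin using (Fin)
open import Data.Fin.Properties using (¬∀⟶∃¬)
open import Data.List using (List; []; _∷_; allFin; cartesianProductWith; filterᵇ)
open import Data.List.Membership.Propositional using (_∈_; find; lose)
import Data.List.Membership.DecPropositional as DecMembership
open import Data.List.Membership.Propositional.Properties
  using (∈-allFin; ∈-cartesianProductWith⁺; ∈-filter⁺; ∈-filter⁻)
open import Data.List.Relation.Unary.All as All using (All; []; _∷_; all?)
open import Data.List.Relation.Unary.Any as Any using (Any; here; there; any?)
open import Data.List.Relation.Unary.Any.Properties using (¬Any[])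
open import Data.Nat using (zero; suc)
open import Data.Product using (_×_; _,_; proj₁; proj₂; ∃; ∃-syntax)
open import Data.Sum as Sum using (_⊎_; inj₁; inj₂; [_,_])
open import Data.Unit using (tt)
open import Data.Vec using (Vec; []; _∷_; lookup)
open import Data.Vec.Properties using (tabulate∘lookup; tabulate-cong; ≡-dec)
open import Function using (id; _∘_)
open import Function.Bundles using (_⇔_; mk⇔; Equivalence)
open import Function.Properties.Equivalence using () renaming (trans to ⇔-trans)
open import Relation.Binary.Definitions using (_Respects_)
open import Relation.Binary.PropositionalEquality
  using (_≡_; _≢_; _≗_; refl; sym; trans; cong; cong₂; subst; module ≡-Reasoning)
open import Relation.Nullary using (Dec; does; yes; no; ¬_; contradiction)
open import Relation.Nullary.Decidable using (map′; dec-true; does-⇔; _×-dec_; _⊎-dec_; _→-dec_; ¬?)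
open import Relation.Unary using (Decidable)

open Equivalence using (to; from)

does⇔ : ∀ {A : Set} (a? : Dec A) → A ⇔ (does a? ≡ true)
does⇔ (yes a) = mk⇔ (λ _ → refl) (λ _ → a)
does⇔ (no ¬a) = mk⇔ (λ a → contradiction a ¬a) (λ ())

∨-true⁻ : ∀ x {y} → x ∨ y ≡ true → x ≡ true ⊎ y ≡ true
∨-true⁻ true  _ = inj₁ refl
∨-true⁻ false e = inj₂ e

∈-filterᵇ⁻ : ∀ {A : Set} (p : A → Bool) {x} xs → x ∈ filterᵇ p xs → p x ≡ true
∈-filterᵇ⁻ p xs x∈ = to T-≡ (proj₂ (∈-filter⁻ (T? ∘ p) {xs = xs} x∈))

∈-filterᵇ⁺ : ∀ {A : Set} (p : A → Bool) {x xs} → x ∈ xs → p x ≡ true → x ∈ filterᵇ p xs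
∈-filterᵇ⁺ p x∈ px = ∈-filter⁺ (T? ∘ p) x∈ (from T-≡ px)

lookup-extensional : ∀ {A : Set} {n} {v w : Vec A n} → (∀ i → lookup v i ≡ lookup w i) → v ≡ w
lookup-extensional {v = v} {w} eq =
  trans (sym (tabulate∘lookup v)) (trans (tabulate-cong eq) (tabulate∘lookup w))

_≟ᵛ_ : ∀ {n} (v w : Valuation n) → Dec (v ≡ w)
_≟ᵛ_ = ≡-dec _≟ᵇ_

_∈ᵛ?_ : ∀ {n} (v : Valuation n) (ws : List (Valuation n)) → Dec (v ∈ ws)
_∈ᵛ?_ = DecMembership._∈?_ _≟ᵛ_

∅ : ∀ {n} → Team n
∅ _ = false

_∩_ : ∀ {n} → Team n → Team n → Team n
(s ∩ t) w = s w ∧ t w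

∁ : ∀ {n} → Team n → Team n
∁ s w = not (s w)

decTeam : ∀ {n} {A : Valuation n → Set} → Decidable A → Team n
decTeam A? w = does (A? w)

｛_｝ : ∀ {n} → Valuation n → Team n
｛ w ｝ = decTeam (_≟ᵛ w)

⟦_⟧ : ∀ {n} → List (Valuation n) → Team n
⟦ ws ⟧ = decTeam (_∈ᵛ? ws)

Disjoint : ∀ {n} → Team n → Team n → Set
Disjoint s t = ∀ w → w ∈ₜ s → w ∈ₜ t → ⊥

same-members⇒≗ : ∀ {n} {s t : Team n} → (∀ w → w ∈ₜ s ⇔ w ∈ₜ t) → s ≗ t
same-members⇒≗ same w = ⇔→≡ (same w)

∈-∩ : ∀ {n} (s t : Team n) {w} → w ∈ₜ (s ∩ t) → w ∈ₜ s × w ∈ₜ t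
∈-∩ s t w∈ = ∧-conicalˡ _ _ w∈ , ∧-conicalʳ _ _ w∈

∈-∪ : ∀ {n} {s : Team n} t u {w} → IsUnion s t u → w ∈ₜ s → w ∈ₜ t ⊎ w ∈ₜ u
∈-∪ t u {w} un w∈s = ∨-true⁻ _ (trans (sym (un w)) w∈s)

∪-∅ʳ : ∀ {n} (t : Team n) → IsUnion t t ∅
∪-∅ʳ t w = sym (∨-identityʳ (t w))

split-by : ∀ {n} (t A : Team n) → IsUnion t (t ∩ ∁ A) (t ∩ A)
split-by t A w = begin
  t w                                ≡⟨ sym (∧-identityʳ (t w)) ⟩
  t w ∧ true                         ≡⟨ cong (t w ∧_) (sym (∨-inverseˡ (A w))) ⟩
  t w ∧ (not (A w) ∨ A w)            ≡⟨ ∧-distribˡ-∨ (t w) (not (A w)) (A w) ⟩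
  (t w ∧ not (A w)) ∨ (t w ∧ A w)    ∎
  where open ≡-Reasoning

valuations : ∀ n → List (Valuation n)
valuations zero    = [] ∷ []
valuations (suc n) = cartesianProductWith _∷_ (true ∷ false ∷ []) (valuations n)

∈-valuations : ∀ {n} (v : Valuation n) → v ∈ valuations n
∈-valuations []      = here refl
∈-valuations (b ∷ v) = ∈-cartesianProductWith⁺ _∷_ (∈-bools b) (∈-valuations v)
  where
  ∈-bools : ∀ b → b ∈ true ∷ false ∷ []
  ∈-bools true  = here refl
  ∈-bools false = there (here refl)

byHead : ∀ {n} → Team n → Team n → Team (suc n)
byHead s t (true  ∷ w) = s w
byHead s t (false ∷ w) = t w

teams : ∀ n → List (Team n)
teams zero    = (λ _ → true) ∷ ∅ ∷ []
teams (suc n) = cartesianProductWith byHead (teams n) (teams n)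

teams-complete : ∀ {n} (t : Team n) → ∃[ s ] (s ∈ teams n × t ≗ s)
teams-complete {zero} t with t [] in eq
... | true  = _ , here refl , λ { [] → eq }
... | false = _ , there (here refl) , λ { [] → eq }
teams-complete {suc n} t
  with teams-complete (t ∘ (true ∷_)) | teams-complete (t ∘ (false ∷_))
... | s , s∈ , t≗s | s′ , s′∈ , t≗s′ =
  byHead s s′ , ∈-cartesianProductWith⁺ byHead s∈ s′∈ ,
  λ { (true ∷ w) → t≗s w ; (false ∷ w) → t≗s′ w }

∀-valuation? : ∀ {n} {A : Valuation n → Set} → Decidable A → Dec (∀ w → A w)
∀-valuation? A? =
  map′ (λ all w → All.lookup all (∈-valuations w)) (λ h → All.tabulate (λ {w} _ → h w))
    (all? A? (valuations _))

∃-valuation? : ∀ {n} {A : Valuation n → Set} → Decidable A → Dec (∃ A)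
∃-valuation? A? =
  map′ (λ any → let w , _ , a = find any in w , a) (λ (w , a) → lose (∈-valuations w) a)
    (any? A? (valuations _))

∃-team? : ∀ {n} {R : Team n → Set} → R Respects _≗_ → Decidable R → Dec (∃ R)
∃-team? {R = R} resp R? =
  map′ (λ any → let s , _ , r = find any in s , r) found (any? R? (teams _))
  where
  found : ∃ R → Any R (teams _)
  found (t , r) = let s , s∈ , t≗s = teams-complete t in lose s∈ (resp t≗s r)

-- Soundness

mutual
  ⊨-resp-≗ : ∀ {n} (φ : Form n) → (_⊨ φ) Respects _≗_
  ⊨-resp-≗ (atom p)  s≗t h w w∈t = h w (trans (s≗t w) w∈t)
  ⊨-resp-≗ bot       s≗t h w = trans (sym (s≗t w)) (h w)
  ⊨-resp-≗ (¬ᶠ φ)    s≗t h = ⊨⁻-resp-≗ φ s≗t h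
  ⊨-resp-≗ (φ ∧ᶠ ψ)  s≗t (a , b) = ⊨-resp-≗ φ s≗t a , ⊨-resp-≗ ψ s≗t b
  ⊨-resp-≗ (φ ∨ᶠ ψ)  s≗t (t₁ , t₂ , un , a , b) =
    t₁ , t₂ , (λ w → trans (sym (s≗t w)) (un w)) , a , b
  ⊨-resp-≗ NE        s≗t (w , w∈s) = w , trans (sym (s≗t w)) w∈s
  ⊨-resp-≗ (φ ⊻ ψ)   s≗t = Sum.map (⊨-resp-≗ φ s≗t) (⊨-resp-≗ ψ s≗t)

  ⊨⁻-resp-≗ : ∀ {n} (φ : Form n) → (_⊨⁻ φ) Respects _≗_
  ⊨⁻-resp-≗ (atom p) s≗t h w w∈t = h w (trans (s≗t w) w∈t)
  ⊨⁻-resp-≗ bot      s≗t h = tt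
  ⊨⁻-resp-≗ (¬ᶠ φ)   s≗t h = ⊨-resp-≗ φ s≗t h
  ⊨⁻-resp-≗ (φ ∧ᶠ ψ) s≗t (t₁ , t₂ , un , a , b) =
    t₁ , t₂ , (λ w → trans (sym (s≗t w)) (un w)) , a , b
  ⊨⁻-resp-≗ (φ ∨ᶠ ψ) s≗t (a , b) = ⊨⁻-resp-≗ φ s≗t a , ⊨⁻-resp-≗ ψ s≗t b
  ⊨⁻-resp-≗ NE       s≗t h w = trans (sym (s≗t w)) (h w)
  ⊨⁻-resp-≗ (φ ⊻ ψ)  s≗t (a , b) = ⊨⁻-resp-≗ φ s≗t a , ⊨⁻-resp-≗ ψ s≗t b

IsUnion? : ∀ {n} (s t u : Team n) → Dec (IsUnion s t u)
IsUnion? s t u = ∀-valuation? (λ w → s w ≟ᵇ (t w ∨ u w))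

∪-split? : ∀ {n} {A B : Team n → Set} → A Respects _≗_ → B Respects _≗_ →
  Decidable A → Decidable B → Decidable (λ s → ∃[ t ] ∃[ u ] (IsUnion s t u × A t × B u))
∪-split? respA respB A? B? s =
  ∃-team? (λ t≗t′ (u , un , a , b) →
             u , (λ w → trans (un w) (cong (_∨ u w) (t≗t′ w))) , respA t≗t′ a , b)
    (λ t → ∃-team? (λ u≗u′ (un , a , b) →
                      (λ w → trans (un w) (cong (t w ∨_) (u≗u′ w))) , a , respB u≗u′ b)
      (λ u → IsUnion? s t u ×-dec A? t ×-dec B? u))

mutual
  _⊨?_ : ∀ {n} (s : Team n) (φ : Form n) → Dec (s ⊨ φ)
  s ⊨? atom p   = ∀-valuation? (λ w → (s w ≟ᵇ true) →-dec (lookup w p ≟ᵇ true))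
  s ⊨? bot      = ∀-valuation? (λ w → s w ≟ᵇ false)
  s ⊨? (¬ᶠ φ)   = s ⊨⁻? φ
  s ⊨? (φ ∧ᶠ ψ) = s ⊨? φ ×-dec s ⊨? ψ
  s ⊨? (φ ∨ᶠ ψ) = ∪-split? (⊨-resp-≗ φ) (⊨-resp-≗ ψ) (_⊨? φ) (_⊨? ψ) s
  s ⊨? NE       = ∃-valuation? (λ w → s w ≟ᵇ true)
  s ⊨? (φ ⊻ ψ)  = s ⊨? φ ⊎-dec s ⊨? ψ

  _⊨⁻?_ : ∀ {n} (s : Team n) (φ : Form n) → Dec (s ⊨⁻ φ)
  s ⊨⁻? atom p   = ∀-valuation? (λ w → (s w ≟ᵇ true) →-dec (lookup w p ≟ᵇ false))
  s ⊨⁻? bot      = yes tt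
  s ⊨⁻? (¬ᶠ φ)   = s ⊨? φ
  s ⊨⁻? (φ ∧ᶠ ψ) = ∪-split? (⊨⁻-resp-≗ φ) (⊨⁻-resp-≗ ψ) (_⊨⁻? φ) (_⊨⁻? ψ) s
  s ⊨⁻? (φ ∨ᶠ ψ) = s ⊨⁻? φ ×-dec s ⊨⁻? ψ
  s ⊨⁻? NE       = ∀-valuation? (λ w → s w ≟ᵇ false)
  s ⊨⁻? (φ ⊻ ψ)  = s ⊨⁻? φ ×-dec s ⊨⁻? ψ

⊨-⊨⁻-disjoint : ∀ {n} (φ : Form n) {s t : Team n} → s ⊨ φ → t ⊨⁻ φ → Disjoint s t
⊨-⊨⁻-disjoint (atom p) hs ht w w∈s w∈t with () ← trans (sym (hs w w∈s)) (ht w w∈t)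
⊨-⊨⁻-disjoint bot      hs ht w w∈s w∈t with () ← trans (sym w∈s) (hs w)
⊨-⊨⁻-disjoint (¬ᶠ φ)   hs ht w w∈s w∈t = ⊨-⊨⁻-disjoint φ ht hs w w∈t w∈s
⊨-⊨⁻-disjoint (φ ∧ᶠ ψ) (a , b) (t₁ , t₂ , un , c , d) w w∈s w∈t =
  [ ⊨-⊨⁻-disjoint φ a c w w∈s , ⊨-⊨⁻-disjoint ψ b d w w∈s ] (∈-∪ t₁ t₂ un w∈t)
⊨-⊨⁻-disjoint (φ ∨ᶠ ψ) (s₁ , s₂ , un , a , b) (c , d) w w∈s w∈t =
  [ (λ w∈s₁ → ⊨-⊨⁻-disjoint φ a c w w∈s₁ w∈t)
  , (λ w∈s₂ → ⊨-⊨⁻-disjoint ψ b d w w∈s₂ w∈t) ] (∈-∪ s₁ s₂ un w∈s)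
⊨-⊨⁻-disjoint NE       hs ht w w∈s w∈t with () ← trans (sym w∈t) (ht w)
⊨-⊨⁻-disjoint (φ ⊻ ψ)  (inj₁ a) (c , d) = ⊨-⊨⁻-disjoint φ a c
⊨-⊨⁻-disjoint (φ ⊻ ψ)  (inj₂ b) (c , d) = ⊨-⊨⁻-disjoint ψ b d

supportᵇ antisupportᵇ : ∀ {n} → Form n → TeamProp n
supportᵇ     φ s = does (s ⊨? φ)
antisupportᵇ φ s = does (s ⊨⁻? φ)

supportᵇ-≐ : ∀ {n} (φ : Form n) → ‖ φ ‖ ≐ supportᵇ φ
supportᵇ-≐ φ s = does⇔ (s ⊨? φ)

antisupportᵇ-≐ : ∀ {n} (φ : Form n) → ‖ ¬ᶠ φ ‖ ≐ antisupportᵇ φ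
antisupportᵇ-≐ φ s = does⇔ (s ⊨⁻? φ)

supportᵇ-extensional : ∀ {n} (φ : Form n) → Extensional (supportᵇ φ)
supportᵇ-extensional φ s t s≗t =
  does-⇔ (mk⇔ (⊨-resp-≗ φ s≗t) (⊨-resp-≗ φ (sym ∘ s≗t))) (s ⊨? φ) (t ⊨? φ)

antisupportᵇ-extensional : ∀ {n} (φ : Form n) → Extensional (antisupportᵇ φ)
antisupportᵇ-extensional φ s t s≗t =
  does-⇔ (mk⇔ (⊨⁻-resp-≗ φ s≗t) (⊨⁻-resp-≗ φ (sym ∘ s≗t))) (s ⊨⁻? φ) (t ⊨⁻? φ)

supportᵇ-groundIncompatible : ∀ {n} (φ : Form n) →
  GroundIncompatible n (supportᵇ φ) (antisupportᵇ φ)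
supportᵇ-groundIncompatible φ s t w Ps Qt =
  ⊨-⊨⁻-disjoint φ (from (supportᵇ-≐ φ s) Ps) (from (antisupportᵇ-≐ φ t) Qt) w

-- Completeness

⊤ᶠ : ∀ {n} → Form n
⊤ᶠ = ¬ᶠ bot

falsum : ∀ {n} → Form n
falsum = bot ∧ᶠ NE

falsum-unsupported : ∀ {n} {t : Team n} → ¬ (t ⊨ falsum)
falsum-unsupported (t-empty , w , w∈t) with () ← trans (sym w∈t) (t-empty w)

falsum-antisupported : ∀ {n} {t : Team n} → t ⊨⁻ falsum
falsum-antisupported {t = t} = t , ∅ , ∪-∅ʳ t , tt , λ _ → refl

-- ¬(ψ ∧ ¬(⊥ ∧ NE)) is never supported, and anti-supported exactly where ψ is supported.
withAntisupport : ∀ {n} → Form n → Form n → Form n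
withAntisupport φ ψ = φ ⊻ (¬ᶠ (ψ ∧ᶠ (¬ᶠ falsum)))

withAntisupport-support : ∀ {n} {φ ψ : Form n} {t} → t ⊨ withAntisupport φ ψ ⇔ t ⊨ φ
withAntisupport-support =
  mk⇔ [ id , (λ (_ , _ , _ , _ , u⊨falsum) → ⊥-elim (falsum-unsupported u⊨falsum)) ] inj₁

withAntisupport-antisupport : ∀ {n} {φ ψ : Form n} → (∀ {t} → t ⊨ ψ → t ⊨⁻ φ) →
  ∀ {t} → t ⊨⁻ withAntisupport φ ψ ⇔ t ⊨ ψ
withAntisupport-antisupport ψ⇒¬φ =
  mk⇔ (λ (_ , t⊨ψ , _) → t⊨ψ) (λ t⊨ψ → ψ⇒¬φ t⊨ψ , t⊨ψ , falsum-antisupported)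

⋀ ⋁∨ ⋁⊻ : ∀ {n} {A : Set} → (A → Form n) → List A → Form n
⋀ F []       = ⊤ᶠ
⋀ F (x ∷ xs) = F x ∧ᶠ ⋀ F xs
⋁∨ F []       = bot
⋁∨ F (x ∷ xs) = F x ∨ᶠ ⋁∨ F xs
⋁⊻ F []       = falsum
⋁⊻ F (x ∷ xs) = F x ⊻ ⋁⊻ F xs

⋀-support : ∀ {n} {A : Set} {F : A → Form n} {t} xs → t ⊨ ⋀ F xs ⇔ All (λ x → t ⊨ F x) xs
⋀-support []       = mk⇔ (λ _ → []) (λ _ → tt)
⋀-support (x ∷ xs) =
  mk⇔ (λ (a , as) → a ∷ to (⋀-support xs) as) (λ { (a ∷ as) → a , from (⋀-support xs) as })

⋁∨-antisupport : ∀ {n} {A : Set} {F : A → Form n} {t} {xs} → All (λ x → t ⊨⁻ F x) xs → t ⊨⁻ ⋁∨ F xs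
⋁∨-antisupport []       = tt
⋁∨-antisupport (a ∷ as) = a , ⋁∨-antisupport as

⋁⊻-support : ∀ {n} {A : Set} {F : A → Form n} {t} xs → t ⊨ ⋁⊻ F xs ⇔ Any (λ x → t ⊨ F x) xs
⋁⊻-support []       = mk⇔ (⊥-elim ∘ falsum-unsupported) (⊥-elim ∘ ¬Any[])
⋁⊻-support (x ∷ xs) =
  mk⇔ (Any.fromSum ∘ Sum.map₂ (to (⋁⊻-support xs))) (Sum.map₂ (from (⋁⊻-support xs)) ∘ Any.toSum)

⋁⊻-antisupport : ∀ {n} {A : Set} {F : A → Form n} {t} {xs} → All (λ x → t ⊨⁻ F x) xs → t ⊨⁻ ⋁⊻ F xs
⋁⊻-antisupport []       = falsum-antisupported
⋁⊻-antisupport (a ∷ as) = a , ⋁⊻-antisupport as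

lit : ∀ {n} → Bool → Fin n → Form n
lit true  i = atom i
lit false i = ¬ᶠ atom i

lit-support : ∀ {n} b (i : Fin n) {t} → t ⊨ lit b i ⇔ (∀ w → w ∈ₜ t → lookup w i ≡ b)
lit-support true  i = mk⇔ id id
lit-support false i = mk⇔ id id

lit-antisupport : ∀ {n} b (i : Fin n) {t} → t ⊨⁻ lit b i ⇔ (∀ w → w ∈ₜ t → lookup w i ≡ not b)
lit-antisupport true  i = mk⇔ id id
lit-antisupport false i = mk⇔ id id

lits-antisupport : ∀ {n} (b : Fin n → Bool) (is : List (Fin n)) {t : Team n} →
  (∀ v → v ∈ₜ t → Any (λ i → lookup v i ≢ b i) is) → t ⊨⁻ ⋀ (λ i → lit (b i) i) is
lits-antisupport b [] {t} differ v = ¬-not {y = true} (λ v∈t → ¬Any[] (differ v v∈t))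
lits-antisupport b (i ∷ is) {t} differ =
  t ∩ ∁ agree , t ∩ agree , split-by t agree , disagreeing , agreeing
  where
  agree? : Decidable (λ v → lookup v i ≡ b i)
  agree? v = lookup v i ≟ᵇ b i
  agree : Team _
  agree = decTeam agree?
  disagreeing : (t ∩ ∁ agree) ⊨⁻ lit (b i) i
  disagreeing = from (lit-antisupport (b i) i) λ v v∈ →
    ¬-not (from (does⇔ (¬? (agree? v))) (proj₂ (∈-∩ t (∁ agree) v∈)))
  agreeing : (t ∩ agree) ⊨⁻ ⋀ (λ i → lit (b i) i) is
  agreeing = lits-antisupport b is λ v v∈ →
    let v∈t , agrees = ∈-∩ t agree v∈
    in Any.tail (λ ne → ne (from (does⇔ (agree? v)) agrees)) (differ v v∈t)

δ : ∀ {n} → Valuation n → Form n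
δ {n} w = ⋀ (λ i → lit (lookup w i) i) (allFin n)

δ-support : ∀ {n} {w : Valuation n} {t} → t ⊨ δ w ⇔ (∀ v → v ∈ₜ t → v ≡ w)
δ-support {n} {w} {t} = mk⇔ to′ from′
  where
  to′ : t ⊨ δ w → ∀ v → v ∈ₜ t → v ≡ w
  to′ h v v∈t = lookup-extensional λ i →
    to (lit-support _ i) (All.lookup (to (⋀-support (allFin n)) h) (∈-allFin i)) v v∈t
  from′ : (∀ v → v ∈ₜ t → v ≡ w) → t ⊨ δ w
  from′ h = from (⋀-support (allFin n)) (All.tabulate λ {i} _ →
    from (lit-support _ i) λ v v∈t → cong (λ u → lookup u i) (h v v∈t))

δ-antisupport : ∀ {n} {w : Valuation n} {t} → ¬ (w ∈ₜ t) → t ⊨⁻ δ w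
δ-antisupport {n} {w} {t} w∉t = lits-antisupport (lookup w) (allFin n) λ v v∈t →
  let i , differ = ¬∀⟶∃¬ n _ (λ i → lookup v i ≟ᵇ lookup w i)
                     (λ agree → w∉t (subst (_∈ₜ t) (lookup-extensional agree) v∈t))
  in lose (∈-allFin i) differ

point : ∀ {n} → Valuation n → Form n
point w = δ w ∧ᶠ NE

point-support : ∀ {n} {w : Valuation n} {t} → t ⊨ point w ⇔ t ≗ ｛ w ｝
point-support {w = w} {t} = mk⇔ to′ from′
  where
  to′ : t ⊨ point w → t ≗ ｛ w ｝
  to′ (t⊆w , u , u∈t) = same-members⇒≗ λ v → mk⇔
    (λ v∈t → to (does⇔ (v ≟ᵛ w)) (to δ-support t⊆w v v∈t))
    (λ v∈w → subst (_∈ₜ t) (trans (to δ-support t⊆w u u∈t) (sym (from (does⇔ (v ≟ᵛ w)) v∈w)))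
                          u∈t)
  from′ : t ≗ ｛ w ｝ → t ⊨ point w
  from′ t≗w = from δ-support (λ v v∈t → from (does⇔ (v ≟ᵛ w)) (trans (sym (t≗w v)) v∈t))
            , w , trans (t≗w w) (dec-true (w ≟ᵛ w) refl)

point-antisupport : ∀ {n} {w : Valuation n} {t} → ¬ (w ∈ₜ t) → t ⊨⁻ point w
point-antisupport {w = w} {t} w∉t = t , ∅ , ∪-∅ʳ t , δ-antisupport {w = w} w∉t , λ _ → refl

-- ⟦ w ∷ ws ⟧ v unfolds definitionally to ｛ w ｝ v ∨ ⟦ ws ⟧ v, so t ≗ ⟦ w ∷ ws ⟧ is itself the splitting.
⋁∨-point-support : ∀ {n} (ws : List (Valuation n)) {t} → t ⊨ ⋁∨ point ws ⇔ t ≗ ⟦ ws ⟧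
⋁∨-point-support []       = mk⇔ id id
⋁∨-point-support (w ∷ ws) = mk⇔
  (λ (t₁ , t₂ , un , p , r) v →
     trans (un v) (cong₂ _∨_ (to point-support p v) (to (⋁∨-point-support ws) r v)))
  (λ t≗ → ｛ w ｝ , ⟦ ws ⟧ , t≗ , from point-support (λ _ → refl)
                           , from (⋁∨-point-support ws) (λ _ → refl))

members : ∀ {n} → Team n → List (Valuation n)
members s = filterᵇ s (valuations _)

⟦members⟧ : ∀ {n} (s : Team n) → ⟦ members s ⟧ ≗ s
⟦members⟧ s = same-members⇒≗ λ v → mk⇔
  (λ v∈ → ∈-filterᵇ⁻ s (valuations _) (from (does⇔ (v ∈ᵛ? members s)) v∈))
  (λ v∈s → to (does⇔ (v ∈ᵛ? members s)) (∈-filterᵇ⁺ s (∈-valuations v) v∈s))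

χ : ∀ {n} → Team n → Form n
χ s = ⋁∨ point (members s)

χ-support : ∀ {n} {s t : Team n} → t ⊨ χ s ⇔ t ≗ s
χ-support {s = s} = mk⇔
  (λ h v → trans (to (⋁∨-point-support (members s)) h v) (⟦members⟧ s v))
  (λ t≗s → from (⋁∨-point-support (members s)) λ v → trans (t≗s v) (sym (⟦members⟧ s v)))

χ-antisupport : ∀ {n} {s t : Team n} → Disjoint s t → t ⊨⁻ χ s
χ-antisupport {s = s} disjoint = ⋁∨-antisupport {xs = members s} (All.tabulate λ {w} w∈ →
  point-antisupport {w = w} (disjoint w (∈-filterᵇ⁻ s (valuations _) w∈)))

satisfying : ∀ {n} → TeamProp n → List (Team n)
satisfying P = filterᵇ P (teams _)

α : ∀ {n} → TeamProp n → Form n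
α P = ⋁⊻ χ (satisfying P)

α-support : ∀ {n} {P : TeamProp n} → Extensional P → ∀ {t} → t ⊨ α P ⇔ P t ≡ true
α-support {P = P} ext-P {t} = mk⇔ to′ from′
  where
  to′ : t ⊨ α P → P t ≡ true
  to′ h = let s , s∈ , t⊨χs = find (to (⋁⊻-support (satisfying P)) h)
          in trans (ext-P t s (to (χ-support {s = s}) t⊨χs)) (∈-filterᵇ⁻ P (teams _) s∈)
  from′ : P t ≡ true → t ⊨ α P
  from′ Pt = let s , s∈ , t≗s = teams-complete t
             in from (⋁⊻-support (satisfying P))
                  (lose (∈-filterᵇ⁺ P s∈ (trans (sym (ext-P t s t≗s)) Pt))
                        (from χ-support t≗s))

α-antisupport : ∀ {n} {P : TeamProp n} {t} → (∀ s → P s ≡ true → Disjoint s t) → t ⊨⁻ α P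
α-antisupport {P = P} disjoint = ⋁⊻-antisupport {xs = satisfying P} (All.tabulate λ {s} s∈ →
  χ-antisupport {s = s} (disjoint s (∈-filterᵇ⁻ P (teams _) s∈)))

complete : ∀ {n} {P Q : TeamProp n} → Extensional P → Extensional Q → GroundIncompatible n P Q →
  ∃[ φ ] ((‖ φ ‖ ≐ P) × (‖ ¬ᶠ φ ‖ ≐ Q))
complete {P = P} {Q} ext-P ext-Q gi =
    withAntisupport (α P) (α Q)
  , (λ t → ⇔-trans (withAntisupport-support {φ = α P} {ψ = α Q}) (α-support ext-P))
  , (λ t → ⇔-trans (withAntisupport-antisupport {φ = α P} {ψ = α Q} αQ⇒¬αP)
                    (α-support ext-Q))
  where
  αQ⇒¬αP : ∀ {t} → t ⊨ α Q → t ⊨⁻ α P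
  αQ⇒¬αP {t} t⊨αQ = α-antisupport λ s Ps w → gi s t w Ps (to (α-support ext-Q) t⊨αQ)

bicomplete : (C : PairClass) →
  (∀ {n} (φ : Form n) → C n (supportᵇ φ) (antisupportᵇ φ)) →
  (∀ {n P Q} → C n P Q → GroundIncompatible n P Q) →
  Bicomplete C
bicomplete C formula-pairs∈C C⊆GI n =
    (λ φ → supportᵇ φ , antisupportᵇ φ , supportᵇ-extensional φ , antisupportᵇ-extensional φ
         , formula-pairs∈C φ , supportᵇ-≐ φ , antisupportᵇ-≐ φ)
  , (λ P Q ext-P ext-Q c → complete ext-P ext-Q (C⊆GI c))

corollary3p15 : Bicomplete GroundIncompatible × Bicomplete (ModuloExpressivePower GroundIncompatible)
corollary3p15 =
    bicomplete GroundIncompatible supportᵇ-groundIncompatible id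
  , bicomplete (ModuloExpressivePower GroundIncompatible)
      (λ φ → supportᵇ-groundIncompatible φ , (φ , supportᵇ-≐ φ) , (¬ᶠ φ , antisupportᵇ-≐ φ))
      proj₁
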